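{- Let $T$ be an increasing tableau of skew shape with $m=\max T$, fix a rectification order, and let $T=T_0,T_1,\ldots,T_p$ be the successive tableaux, where $T_j$ is obtained from $T_{j-1}$ by a $K$-jeu de taquin slide and $T_p$ has straight shape. For $0\le i\le m$ and $0\le r\le p$ let $G(i,r)=\mu^{(p-r)}_i$, where $\mu^{(j)}_i$ denotes the union of the inner shape of $T_j$ with the boxes of $T_j$ having label $\le i$. Consider any $2\times2$ square of this $K$-theory growth diagram, i.e. $\alpha=G(i,r+1)$, $\beta=G(i+1,r+1)$, $\gamma=G(i,r)$, $\delta=G(i+1,r)$ for some $0\le i<m$, $0\le r<p$ (so that $\gamma\subseteq\alpha\subseteq\beta$ and $\gamma\subseteq\delta\subseteq\beta$). Then: (G1) each of $\alpha/\gamma$, $\beta/\alpha$, $\beta/\delta$, $\delta/\gamma$ is a set of boxes no two of which lie in the same row or the same column; (G2) if $F$ denotes the filling of $\beta/\alpha$ with all entries equal to $1$, then $K\mathtt{jdt}_{\alpha/\gamma}(F)$ (the $K$-jeu de taquin slide of $F$ using the boxes of $\alpha/\gamma$ as the set of inner corners) has shape $\delta/\gamma$; symmetrically, if $F'$ denotes the filling of $\beta/\delta$ by $1$'s, then $K\mathtt{jdt}_{\delta/\gamma}(F')$ has shape $\alpha/\gamma$.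
   Context: An increasing tableau of skew shape $\nu/\lambda$ is a filling of $\nu/\lambda$ with labels from $\{1,\ldots,q\}$, each used at least once, strictly increasing along rows and down columns; $\max T$ is its largest label, and $\lambda$ is its inner shape. An inner corner of $\nu/\lambda$ is a box $x\in\lambda$ with $\lambda\setminus\{x\}$ a partition. $K$-jeu de taquin slide $K\mathtt{jdt}_{\{x_j\}}(T)$: put $\bullet$ in each of the chosen nonempty set of inner corners; for $i=1,\ldots,\max T$ in turn, in every edge-connected component with at least two boxes of the set of boxes containing $\bullet$ or $i$, interchange $\bullet$ and $i$ (single-box components unchanged); finally delete the $\bullet$ boxes. (Slides preserve the set of labels, so every $T_j$ has maximum label $m$.) A rectification order is a sequence of choices of nonempty sets of inner corners for successive slides until a straight shape is reached. -}

module Defs where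

open import Data.Nat using (ℕ; zero; suc; _<_; _≤_; _∸_; _≡ᵇ_; _≤ᵇ_)
open import Data.Bool using (Bool; true; false; _∧_; _∨_; not; if_then_else_)
open import Data.Product using (_×_; _,_; proj₁; proj₂; ∃)
open import Data.Maybe using (Maybe; just; nothing)
open import Data.List using (List; []; _∷_; _++_)
open import Data.Bool.ListAction using (any)
open import Data.Sum using (_⊎_)
open import Relation.Binary.PropositionalEquality using (_≡_)

-- Boxes and shapes (English convention: box (r , c) = row r, column c,
-- both 0-indexed; rows go down, columns go right)

Box : Set
Box = ℕ × ℕ

Shape : Set
Shape = Box → Bool

_∈ₛ_ : Box → Shape → Set
b ∈ₛ S = S b ≡ true

∅ₛ : Shape
∅ₛ _ = false

_∖ₛ_ : Shape → Shape → Shape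
(X ∖ₛ Y) b = X b ∧ not (Y b)

_==B_ : Box → Box → Bool
(r , c) ==B (r' , c') = (r ≡ᵇ r') ∧ (c ≡ᵇ c')

removeBox : Box → Shape → Shape
removeBox x S b = S b ∧ not (x ==B b)

IsPartition : Shape → Set
IsPartition S =
  (∃ λ N → ∀ r c → (r , c) ∈ₛ S → (r < N × c < N)) ×
  (∀ r c r' c' → r' ≤ r → c' ≤ c → (r , c) ∈ₛ S → (r' , c') ∈ₛ S)

-- Tableaux: inner shape, a partial filling by positive labels, and the
-- label bound mx (= max T for an increasing tableau, see HasLabels).

record Tableau : Set where
  constructor tab
  field
    inner : Shape
    fill  : Box → Maybe ℕ
    mx    : ℕ
open Tableau public

filled : (Box → Maybe ℕ) → Shape
filled f b with f b
... | just _  = true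
... | nothing = false

outer : Tableau → Shape
outer T b = inner T b ∨ filled (fill T) b

HasLabels : (Box → Maybe ℕ) → ℕ → Set
HasLabels f q =
  (∀ b k → f b ≡ just k → (1 ≤ k × k ≤ q)) ×
  (∀ k → 1 ≤ k → k ≤ q → ∃ λ b → f b ≡ just k)

IsIncreasingTableau : Tableau → Set
IsIncreasingTableau T =
  IsPartition (inner T) ×
  IsPartition (outer T) ×
  (∀ b → b ∈ₛ inner T → filled (fill T) b ≡ false) ×
  HasLabels (fill T) (mx T) ×
  (∀ r c c' a a' → c < c' → fill T (r , c) ≡ just a → fill T (r , c') ≡ just a' → a < a') ×
  (∀ r r' c a a' → r < r' → fill T (r , c) ≡ just a → fill T (r' , c) ≡ just a' → a < a')

IsInnerCorner : Tableau → Box → Set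
IsInnerCorner T x = (x ∈ₛ inner T) × IsPartition (removeBox x (inner T))

IsCornerSet : Tableau → Shape → Set
IsCornerSet T C = (∃ λ b → b ∈ₛ C) × (∀ b → b ∈ₛ C → IsInnerCorner T b)

IsStraight : Tableau → Set
IsStraight T = ∀ b → inner T b ≡ false

data Cell : Set where
  emp : Cell
  bul : Cell
  lab : ℕ → Cell

active : ℕ → Cell → Bool
active i emp     = false
active i bul     = true
active i (lab k) = k ≡ᵇ i

swapC : ℕ → Cell → Cell
swapC i emp     = emp
swapC i bul     = lab i
swapC i (lab k) = bul

neighbours : Box → List Box
neighbours (r , c) = (suc r , c) ∷ (r , suc c) ∷ (up r ++ left c)
  where
  up : ℕ → List Box
  up zero    = []
  up (suc r') = (r' , c) ∷ []
  left : ℕ → List Box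
  left zero    = []
  left (suc c') = (r , c') ∷ []

-- step i: a box containing • or i lies in an edge-connected component
-- (of the boxes containing • or i) with ≥ 2 boxes iff it has an
-- edge-neighbour containing • or i; in such components interchange.
kstep : ℕ → (Box → Cell) → Box → Cell
kstep i g b =
  if active i (g b) ∧ any (λ b' → active i (g b')) (neighbours b)
  then swapC i (g b) else g b

ksteps : ℕ → (Box → Cell) → Box → Cell
ksteps zero    g = g
ksteps (suc n) g = kstep (suc n) (ksteps n g)

toCell : Maybe ℕ → Cell
toCell (just k) = lab k
toCell nothing  = emp

fromCell : Cell → Maybe ℕ
fromCell (lab k) = just k
fromCell _       = nothing

initCells : Shape → Tableau → Box → Cell
initCells C T b = if C b then bul else toCell (fill T b)

Kjdt : Shape → Tableau → Tableau
Kjdt C T = tab (inner T ∖ₛ C) (λ b → fromCell (ksteps (mx T) (initCells C T) b)) (mx T)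

-- T_j for a rectification order given by the corner sets C 0, C 1, …
run : Tableau → (ℕ → Shape) → ℕ → Tableau
run T C zero    = T
run T C (suc j) = Kjdt (C j) (run T C j)

labelLE : (Box → Maybe ℕ) → ℕ → Shape
labelLE f i b with f b
... | just k  = k ≤ᵇ i
... | nothing = false

μ : Tableau → ℕ → Shape
μ Tj i b = inner Tj b ∨ labelLE (fill Tj) i b

G : Tableau → (ℕ → Shape) → ℕ → ℕ → ℕ → Shape
G T C p i r = μ (run T C (p ∸ r)) i

IsRookSet : Shape → Set
IsRookSet S = ∀ b b' → b ∈ₛ S → b' ∈ₛ S →
  (proj₁ b ≡ proj₁ b' ⊎ proj₂ b ≡ proj₂ b') → b ≡ b'

onesFill : Shape → Box → Maybe ℕ
onesFill S b = if S b then just 1 else nothing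

HasShape : Tableau → Shape → Shape → Set
HasShape R ν lam = (∀ b → outer R b ≡ ν b) × (∀ b → inner R b ≡ lam b)

-- The maximum label q of that filling is pinned down
-- by the standing convention (labels are exactly {1..q}).
SlideProp : Shape → Shape → Shape → Shape → Set
SlideProp α β γ δ =
  ∀ q → HasLabels (onesFill (β ∖ₛ α)) q →
  HasShape (Kjdt (α ∖ₛ γ) (tab α (onesFill (β ∖ₛ α)) q)) δ γ

GrowthSquare : Shape → Shape → Shape → Shape → Set
GrowthSquare α β γ δ =
  (IsRookSet (α ∖ₛ γ) × IsRookSet (β ∖ₛ α) × IsRookSet (β ∖ₛ δ) × IsRookSet (δ ∖ₛ γ)) ×
  (SlideProp α β γ δ × SlideProp δ β γ α)

-- A square of the diagram involves one slide T_j ↦ T_{j+1} (j = p - r - 1)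
-- and two consecutive labels i, i + 1, so everything is a statement about a
-- single K-jeu de taquin slide of a tableau T into corners C.
module Submission where

open import Defs
open import Data.Nat using (ℕ; zero; suc; _<_; _≤_; _∸_; _+_; _≡ᵇ_; _≤ᵇ_; z≤n; s≤s)
open import Data.Nat.Properties
open import Data.Bool using (Bool; true; false; _∧_; _∨_; not; if_then_else_)
open import Data.Bool.Properties using (T-≡; ∧-conicalˡ; ∧-conicalʳ; ∨-assoc; ∧-zeroʳ; ∧-identityʳ)
open import Data.Product using (_×_; _,_; proj₁; proj₂; ∃)
open import Data.Maybe using (Maybe; just; nothing)
open import Data.List.Properties using (map-cong)
open import Data.List.Relation.Unary.Any using (here; there)
open import Data.List.Relation.Unary.Any.Properties using (any⁺; any⁻)
open import Data.List.Membership.Propositional using (_∈_; find; lose)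
open import Data.Bool.ListAction using (any; or)
open import Data.Sum using (_⊎_; inj₁; inj₂)
open import Data.Empty using (⊥; ⊥-elim)
open import Function.Bundles using (Equivalence)
open import Relation.Nullary using (¬_; yes; no)
open import Relation.Binary using (tri<; tri≈; tri>)
open import Relation.Binary.PropositionalEquality

open Equivalence using (to; from)

true≢false : true ≡ false → ⊥
true≢false ()

bool-cases : ∀ x → x ≡ true ⊎ x ≡ false
bool-cases true  = inj₁ refl
bool-cases false = inj₂ refl

∨-cases : ∀ x y → x ∨ y ≡ true → x ≡ true ⊎ y ≡ true
∨-cases true  y _ = inj₁ refl
∨-cases false y e = inj₂ e

∨-introˡ : ∀ x y → x ≡ true → x ∨ y ≡ true
∨-introˡ true y _ = refl

∨-introʳ : ∀ x y → y ≡ true → x ∨ y ≡ true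
∨-introʳ true  y _ = refl
∨-introʳ false y e = e

∧-intro : ∀ x y → x ≡ true → y ≡ true → x ∧ y ≡ true
∧-intro true true _ _ = refl

not-true : ∀ x → not x ≡ true → x ≡ false
not-true false _ = refl

not-false : ∀ x → x ≡ false → not x ≡ true
not-false false _ = refl

≡ᵇ-refl : ∀ n → (n ≡ᵇ n) ≡ true
≡ᵇ-refl n = to T-≡ (≡⇒≡ᵇ n n refl)

≡ᵇ-sound : ∀ m n → (m ≡ᵇ n) ≡ true → m ≡ n
≡ᵇ-sound m n e = ≡ᵇ⇒≡ m n (from T-≡ e)

≡ᵇ-false : ∀ m n → ¬ (m ≡ n) → (m ≡ᵇ n) ≡ false
≡ᵇ-false m n m≢n with m ≡ᵇ n in e
... | true  = ⊥-elim (m≢n (≡ᵇ-sound m n e))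
... | false = refl

≤ᵇ-sound : ∀ m n → (m ≤ᵇ n) ≡ true → m ≤ n
≤ᵇ-sound m n e = ≤ᵇ⇒≤ m n (from T-≡ e)

≤ᵇ-true : ∀ m n → m ≤ n → (m ≤ᵇ n) ≡ true
≤ᵇ-true m n m≤n = to T-≡ (≤⇒≤ᵇ m≤n)

≤ᵇ-false : ∀ m n → n < m → (m ≤ᵇ n) ≡ false
≤ᵇ-false m n n<m with m ≤ᵇ n in e
... | true  = ⊥-elim (<⇒≱ n<m (≤ᵇ-sound m n e))
... | false = refl

==B-refl : ∀ b → (b ==B b) ≡ true
==B-refl (r , c) rewrite ≡ᵇ-refl r | ≡ᵇ-refl c = refl

==B-sound : ∀ b b' → (b ==B b') ≡ true → b ≡ b'
==B-sound (r , c) (r' , c') e =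
  cong₂ _,_ (≡ᵇ-sound r r' (∧-conicalˡ _ _ e)) (≡ᵇ-sound c c' (∧-conicalʳ _ _ e))

any-∈ : ∀ {A : Set} (P : A → Bool) {x xs} → x ∈ xs → P x ≡ true → any P xs ≡ true
any-∈ P x∈xs Px = to T-≡ (any⁺ P (lose x∈xs (from T-≡ Px)))

neighbour-adjacent : ∀ b b' → b' ∈ neighbours b →
  ¬ (b ≡ b') × (proj₁ b ≡ proj₁ b' ⊎ proj₂ b ≡ proj₂ b')
neighbour-adjacent (r , c) _ (here refl) = (λ e → 1+n≢n (sym (cong proj₁ e))) , inj₂ refl
neighbour-adjacent (r , c) _ (there (here refl)) = (λ e → 1+n≢n (sym (cong proj₂ e))) , inj₁ refl
neighbour-adjacent (zero , zero) _ (there (there ()))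
neighbour-adjacent (zero , suc c) _ (there (there (here refl))) = (λ e → 1+n≢n (cong proj₂ e)) , inj₁ refl
neighbour-adjacent (zero , suc c) _ (there (there (there ())))
neighbour-adjacent (suc r , zero) _ (there (there (here refl))) = (λ e → 1+n≢n (cong proj₁ e)) , inj₂ refl
neighbour-adjacent (suc r , zero) _ (there (there (there ())))
neighbour-adjacent (suc r , suc c) _ (there (there (here refl))) = (λ e → 1+n≢n (cong proj₁ e)) , inj₂ refl
neighbour-adjacent (suc r , suc c) _ (there (there (there (here refl)))) = (λ e → 1+n≢n (cong proj₂ e)) , inj₁ refl
neighbour-adjacent (suc r , suc c) _ (there (there (there (there ()))))

stepCell : ℕ → Cell → Bool → Cell
stepCell i emp     _ = emp
stepCell i bul     n = if n then lab i else bul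
stepCell i (lab a) n = if (a ≡ᵇ i) ∧ n then bul else lab a

activeNeighbour : ℕ → (Box → Cell) → Box → Bool
activeNeighbour i g b = any (λ b' → active i (g b')) (neighbours b)

kstep-closed : ∀ i g b → kstep i g b ≡ stepCell i (g b) (activeNeighbour i g b)
kstep-closed i g b with g b
... | emp   = refl
... | bul   = refl
... | lab a = refl

stepCell-other : ∀ i a n → ¬ (a ≡ i) → stepCell i (lab a) n ≡ lab a
stepCell-other i a n a≢i rewrite ≡ᵇ-false a i a≢i = refl

stepCell-same : ∀ i n → stepCell i (lab i) n ≡ (if n then bul else lab i)
stepCell-same i n rewrite ≡ᵇ-refl i = refl

stepCell-inactive : ∀ i c n → active i c ≡ false → stepCell i c n ≡ c
stepCell-inactive i emp     n _ = refl
stepCell-inactive i (lab a) n e rewrite e = refl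

stepCell-isolated : ∀ i c → stepCell i c false ≡ c
stepCell-isolated i emp = refl
stepCell-isolated i bul = refl
stepCell-isolated i (lab a) rewrite ∧-zeroʳ (a ≡ᵇ i) = refl

stepCell-active : ∀ i c n → active i (stepCell i c n) ≡ active i c
stepCell-active i emp     n     = refl
stepCell-active i bul     true  = ≡ᵇ-refl i
stepCell-active i bul     false = refl
stepCell-active i (lab a) n with a ≡ᵇ i in e
... | false = e
... | true with n
...   | true  = refl
...   | false = e

nonEmpty : Cell → Bool
nonEmpty emp     = false
nonEmpty bul     = true
nonEmpty (lab _) = true

NonEmpty : Cell → Set
NonEmpty c = nonEmpty c ≡ true

nonEmpty-stepCell : ∀ i c n → nonEmpty (stepCell i c n) ≡ nonEmpty c
nonEmpty-stepCell i emp     n     = refl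
nonEmpty-stepCell i bul     false = refl
nonEmpty-stepCell i bul     true  = refl
nonEmpty-stepCell i (lab a) n with (a ≡ᵇ i) ∧ n
... | true  = refl
... | false = refl

nonEmpty-kstep : ∀ i g b → nonEmpty (kstep i g b) ≡ nonEmpty (g b)
nonEmpty-kstep i g b rewrite kstep-closed i g b = nonEmpty-stepCell i (g b) _

-- The order of nonempty cells at stage k: a bullet counts as k + ½.
Before : ℕ → Cell → Cell → Set
Before k emp     _       = ⊥
Before k _       emp     = ⊥
Before k bul     bul     = ⊥
Before k bul     (lab b) = k < b
Before k (lab a) bul     = a ≤ k
Before k (lab a) (lab b) = a < b

Before-irrefl : ∀ k c → Before k c c → ⊥
Before-irrefl k emp     ()
Before-irrefl k bul     ()
Before-irrefl k (lab a) a<a = <-irrefl refl a<a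

nothing-between : ∀ k z → Before k bul z → Before k z (lab (suc k)) → ⊥
nothing-between k emp     ()  _
nothing-between k bul     ()  _
nothing-between k (lab c) k<c c<k+1 = <⇒≱ k<c (≤-pred c<k+1)

Before-step : ∀ k cx cy nx ny → Before k cx cy →
  (cx ≡ bul → cy ≡ lab (suc k) → nx ≡ true × ny ≡ true) →
  Before (suc k) (stepCell (suc k) cx nx) (stepCell (suc k) cy ny)
Before-step k bul (lab b) nx ny k<b swap with b ≟ suc k
... | yes refl with swap refl refl
...   | refl , refl rewrite stepCell-same (suc k) true = ≤-refl
Before-step k bul (lab b) nx ny k<b swap | no b≢k+1
  rewrite stepCell-other (suc k) b ny b≢k+1 with nx
... | true  = ≤∧≢⇒< k<b (λ e → b≢k+1 (sym e))
... | false = ≤∧≢⇒< k<b (λ e → b≢k+1 (sym e))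
Before-step k (lab a) bul nx ny a≤k swap
  rewrite stepCell-other (suc k) a nx (<⇒≢ (s≤s a≤k)) with ny
... | true  = s≤s a≤k
... | false = m≤n⇒m≤1+n a≤k
Before-step k (lab a) (lab b) nx ny a<b swap with a ≟ suc k | b ≟ suc k
... | yes refl | yes refl = ⊥-elim (<-irrefl refl a<b)
... | yes refl | no b≢k+1 rewrite stepCell-same (suc k) nx | stepCell-other (suc k) b ny b≢k+1 with nx
...   | true  = a<b
...   | false = a<b
Before-step k (lab a) (lab b) nx ny a<b swap | no a≢k+1 | yes refl
  rewrite stepCell-same (suc k) ny | stepCell-other (suc k) a nx a≢k+1 with ny
...   | true  = <⇒≤ a<b
...   | false = a<b
Before-step k (lab a) (lab b) nx ny a<b swap | no a≢k+1 | no b≢k+1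
  rewrite stepCell-other (suc k) a nx a≢k+1 | stepCell-other (suc k) b ny b≢k+1 = a<b

DownClosed : Shape → Set
DownClosed S = ∀ r c r' c' → r' ≤ r → c' ≤ c → (r , c) ∈ₛ S → (r' , c') ∈ₛ S

-- A family of lines (rows or columns): 'at a c' is the c-th box of line a.
-- Consecutive boxes are neighbours, and boxes move weakly south-east.
record Lines : Set where
  field
    at        : ℕ → ℕ → Box
    next-near : ∀ (P : Box → Bool) a c → P (at a (suc c)) ≡ true → any P (neighbours (at a c)) ≡ true
    prev-near : ∀ (P : Box → Bool) a c → P (at a c) ≡ true → any P (neighbours (at a (suc c))) ≡ true
    monotone  : ∀ a c c' → c ≤ c' → proj₁ (at a c) ≤ proj₁ (at a c') × proj₂ (at a c) ≤ proj₂ (at a c')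
    injective : ∀ a c c' → at a c ≡ at a c' → c ≡ c'
open Lines public

initial : ∀ L S → DownClosed S → ∀ a c c' → c ≤ c' → at L a c' ∈ₛ S → at L a c ∈ₛ S
initial L S closed a c c' c≤c' = closed _ _ _ _ (proj₁ mono) (proj₂ mono)
  where
  mono : proj₁ (at L a c) ≤ proj₁ (at L a c') × proj₂ (at L a c) ≤ proj₂ (at L a c')
  mono = monotone L a c c' c≤c'

data Direction : Set where
  rows cols : Direction

lines : Direction → Lines
lines rows = record
  { at        = λ r c → (r , c)
  ; next-near = λ P r c → any-∈ P {xs = neighbours (r , c)} (there (here refl))
  ; prev-near = left
  ; monotone  = λ r c c' c≤c' → ≤-refl , c≤c'
  ; injective = λ r c c' → cong proj₂
  }
  where
  left : ∀ (P : Box → Bool) r c → P (r , c) ≡ true → any P (neighbours (r , suc c)) ≡ true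
  left P zero    c = any-∈ P {xs = neighbours (zero , suc c)} (there (there (here refl)))
  left P (suc r) c = any-∈ P {xs = neighbours (suc r , suc c)} (there (there (there (here refl))))
lines cols = record
  { at        = λ c r → (r , c)
  ; next-near = λ P c r → any-∈ P {xs = neighbours (r , c)} (here refl)
  ; prev-near = λ P c r → any-∈ P {xs = neighbours (suc r , c)} (there (there (here refl)))
  ; monotone  = λ c r r' r≤r' → r≤r' , ≤-refl
  ; injective = λ c r r' → cong proj₁
  }

Increasing : Lines → ℕ → (Box → Cell) → Set
Increasing L k g = ∀ a c c' → c < c' → NonEmpty (g (at L a c)) → NonEmpty (g (at L a c')) →
  Before k (g (at L a c)) (g (at L a c'))

Gapless : Lines → (Box → Cell) → Set
Gapless L g = ∀ a c c'' c' → c < c'' → c'' < c' →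
  NonEmpty (g (at L a c)) → NonEmpty (g (at L a c')) → NonEmpty (g (at L a c''))

gapless-kstep : ∀ L i g → Gapless L g → Gapless L (kstep i g)
gapless-kstep L i g gapless a c c'' c' c<c'' c''<c' nx ny
  rewrite nonEmpty-kstep i g (at L a c) | nonEmpty-kstep i g (at L a c') | nonEmpty-kstep i g (at L a c'')
  = gapless a c c'' c' c<c'' c''<c' nx ny

-- Step k + 1 keeps the line increasing: a bullet followed by k + 1 must be
-- directly adjacent to it (gaplessness and 'nothing-between'), so they swap.
increasing-kstep : ∀ L k g → Increasing L k g → Gapless L g → Increasing L (suc k) (kstep (suc k) g)
increasing-kstep L k g increasing gapless a c c' c<c' nx ny
  rewrite kstep-closed (suc k) g (at L a c) | kstep-closed (suc k) g (at L a c')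
  = Before-step k (g x) (g y) _ _ (increasing a c c' c<c' nx' ny') swapped
  where
  x y : Box
  x = at L a c
  y = at L a c'
  nx' : NonEmpty (g x)
  nx' = trans (sym (nonEmpty-stepCell (suc k) (g x) _)) nx
  ny' : NonEmpty (g y)
  ny' = trans (sym (nonEmpty-stepCell (suc k) (g y) _)) ny
  isActive : Box → Bool
  isActive b = active (suc k) (g b)
  swapped : g x ≡ bul → g y ≡ lab (suc k) →
    activeNeighbour (suc k) g x ≡ true × activeNeighbour (suc k) g y ≡ true
  swapped gx gy with m≤n⇒m<n∨m≡n c<c'
  ... | inj₂ refl = next-near L isActive a c (trans (cong (active (suc k)) gy) (≡ᵇ-refl (suc k)))
                  , prev-near L isActive a c (cong (active (suc k)) gx)
  ... | inj₁ c+1<c' = ⊥-elim (nothing-between k (g z)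
          (subst (λ w → Before k w (g z)) gx (increasing a c (suc c) ≤-refl nx' nz))
          (subst (Before k (g z)) gy (increasing a (suc c) c' c+1<c' nz ny')))
    where
    z : Box
    z = at L a (suc c)
    nz : NonEmpty (g z)
    nz = gapless a c (suc c) c' ≤-refl c+1<c' nx' ny'

filled-just : ∀ f b {a} → f b ≡ just a → filled f b ≡ true
filled-just f b e with f b
filled-just f b refl | just _ = refl

filled-nothing : ∀ f b → f b ≡ nothing → filled f b ≡ false
filled-nothing f b e with f b
filled-nothing f b refl | nothing = refl

filled-true : ∀ f b → filled f b ≡ true → ∃ λ a → f b ≡ just a
filled-true f b e with f b
filled-true f b e  | just a  = a , refl
filled-true f b () | nothing

filled-false : ∀ f b → filled f b ≡ false → f b ≡ nothing
filled-false f b e with f b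
filled-false f b () | just _
filled-false f b e  | nothing = refl

just≢nothing : ∀ {x : ℕ} → just x ≡ nothing → ⊥
just≢nothing ()

nonEmpty≢emp : ∀ {c} → NonEmpty c → c ≡ emp → ⊥
nonEmpty≢emp ne refl = true≢false (sym ne)

fromCell-just : ∀ c {a} → fromCell c ≡ just a → c ≡ lab a
fromCell-just (lab a) refl = refl

FillIncreasing : Lines → Tableau → Set
FillIncreasing L T = ∀ a c c' x y → c < c' →
  fill T (at L a c) ≡ just x → fill T (at L a c') ≡ just y → x < y

-- A well-formed tableau: an increasing tableau, except that the labels need
-- not exhaust {1, …, mx T}.  This is the invariant preserved by slides.
record WellFormed (T : Tableau) : Set where
  field
    inner-closed   : DownClosed (inner T)
    outer-closed   : DownClosed (outer T)
    inner-unfilled : ∀ b → inner T b ≡ true → fill T b ≡ nothing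
    label-bounds   : ∀ b a → fill T b ≡ just a → 1 ≤ a × a ≤ mx T
    fill-increasing : ∀ d → FillIncreasing (lines d) T

increasing⇒wellFormed : ∀ T → IsIncreasingTableau T → WellFormed T
increasing⇒wellFormed T (λ-partition , ν-partition , unfilled , labels , rows-inc , cols-inc) = record
  { inner-closed    = proj₂ λ-partition
  ; outer-closed    = proj₂ ν-partition
  ; inner-unfilled  = λ b e → filled-false (fill T) b (unfilled b e)
  ; label-bounds    = proj₁ labels
  ; fill-increasing = λ where
      rows a c c' x y → rows-inc a c c' x y
      cols a c c' x y c<c' → cols-inc c c' a x y c<c'
  }

Corners : Tableau → Shape → Set
Corners T C = ∀ b → C b ≡ true → IsInnerCorner T b

-- An inner corner x has no other box of λ weakly south-east of it, since
-- λ with x removed is still down-closed.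
corner-maximal : ∀ T x → IsInnerCorner T x → ∀ y →
  proj₁ x ≤ proj₁ y → proj₂ x ≤ proj₂ y → y ∈ₛ inner T → x ≡ y
corner-maximal T x (_ , _ , closed) y r≤r' c≤c' y∈λ with bool-cases (x ==B y)
... | inj₁ same      = ==B-sound x y same
... | inj₂ different = ⊥-elim (true≢false (trans (sym x-kept) x-removed))
  where
  x-kept : removeBox x (inner T) x ≡ true
  x-kept = closed _ _ _ _ r≤r' c≤c' (∧-intro _ _ y∈λ (not-false _ different))
  x-removed : removeBox x (inner T) x ≡ false
  x-removed rewrite ==B-refl x | ∧-zeroʳ (inner T x) = refl

corner-last : ∀ L T C → Corners T C → ∀ a c c' → c < c' →
  C (at L a c) ≡ true → inner T (at L a c') ≡ true → ⊥
corner-last L T C corners a c c' c<c' corner later =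
  <-irrefl (injective L a c c' (corner-maximal T _ (corners _ corner) _ (proj₁ mono) (proj₂ mono) later)) c<c'
  where
  mono : proj₁ (at L a c) ≤ proj₁ (at L a c') × proj₂ (at L a c) ≤ proj₂ (at L a c')
  mono = monotone L a c c' (<⇒≤ c<c')

data StartCell (C : Shape) (T : Tableau) (b : Box) : Set where
  start-bul : C b ≡ true → initCells C T b ≡ bul → StartCell C T b
  start-lab : C b ≡ false → ∀ a → fill T b ≡ just a → initCells C T b ≡ lab a → StartCell C T b
  start-emp : C b ≡ false → fill T b ≡ nothing → initCells C T b ≡ emp → StartCell C T b

initCells-at : ∀ C T b {v} → C b ≡ v → initCells C T b ≡ (if v then bul else toCell (fill T b))
initCells-at C T b refl = refl

startCell : ∀ C T b → StartCell C T b
startCell C T b with C b in inC | fill T b in f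
... | true  | _       = start-bul inC (initCells-at C T b inC)
... | false | just a  = start-lab inC a f (trans (initCells-at C T b inC) (cong toCell f))
... | false | nothing = start-emp inC f (trans (initCells-at C T b inC) (cong toCell f))

data Low (n : ℕ) : Cell → Set where
  low-bul : Low n bul
  low-lab : ∀ {a} → 1 ≤ a → a ≤ n → Low n (lab a)

data Evolved (n : ℕ) : Bool → Maybe ℕ → Cell → Set where
  corner  : ∀ {f c} → Low n c → Evolved n true f c
  empty   : Evolved n false nothing emp
  waiting : ∀ {a} → n < a → Evolved n false (just a) (lab a)
  settled : ∀ {a c} → a ≤ n → Low n c → Evolved n false (just a) c

Low-step : ∀ n c x → Low n c → Low (suc n) (stepCell (suc n) c x)
Low-step n bul true low-bul = low-lab (s≤s z≤n) ≤-refl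
Low-step n bul false low-bul = low-bul
Low-step n (lab a) x (low-lab 1≤a a≤n)
  rewrite stepCell-other (suc n) a x (<⇒≢ (s≤s a≤n)) = low-lab 1≤a (m≤n⇒m≤1+n a≤n)

Evolved-step : ∀ n inC f c x → Evolved n inC f c → Evolved (suc n) inC f (stepCell (suc n) c x)
Evolved-step n true f c x (corner low) = corner (Low-step n c x low)
Evolved-step n false nothing emp x empty = empty
Evolved-step n false (just a) (lab a) x (waiting n<a) with a ≟ suc n
... | yes refl rewrite stepCell-same (suc n) x with x
...   | true  = settled ≤-refl low-bul
...   | false = settled ≤-refl (low-lab (s≤s z≤n) ≤-refl)
Evolved-step n false (just a) (lab a) x (waiting n<a) | no a≢n+1
  rewrite stepCell-other (suc n) a x a≢n+1 = waiting (≤∧≢⇒< n<a (λ e → a≢n+1 (sym e)))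
Evolved-step n false (just a) c x (settled a≤n low) = settled (m≤n⇒m≤1+n a≤n) (Low-step n c x low)

Evolved-bound : ∀ n inC f c a → Evolved n inC f c → c ≡ lab a →
  (∀ x → f ≡ just x → 1 ≤ x × x ≤ n) → 1 ≤ a × a ≤ n
Evolved-bound n inC f _ a (corner (low-lab 1≤a a≤n)) refl _ = 1≤a , a≤n
Evolved-bound n inC (just x) _ x (waiting _) refl bounds = bounds x refl
Evolved-bound n inC f _ a (settled _ (low-lab 1≤a a≤n)) refl _ = 1≤a , a≤n

Evolved-nonEmpty : ∀ n inC f c → Evolved n inC f c → (inC ≡ true ⊎ ∃ λ x → f ≡ just x) → NonEmpty c
Evolved-nonEmpty n inC f c (corner low-bul) _ = refl
Evolved-nonEmpty n inC f c (corner (low-lab _ _)) _ = refl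
Evolved-nonEmpty n inC f c empty (inj₁ ())
Evolved-nonEmpty n inC f c empty (inj₂ (_ , ()))
Evolved-nonEmpty n inC f c (waiting _) _ = refl
Evolved-nonEmpty n inC f c (settled _ low-bul) _ = refl
Evolved-nonEmpty n inC f c (settled _ (low-lab _ _)) _ = refl

Evolved-origin : ∀ n inC f c → Evolved n inC f c → NonEmpty c → (inC ≡ true ⊎ ∃ λ x → f ≡ just x)
Evolved-origin n inC f c (corner _) _ = inj₁ refl
Evolved-origin n inC (just x) c (waiting _) _ = inj₂ (x , refl)
Evolved-origin n inC (just x) c (settled _ _) _ = inj₂ (x , refl)

Evolved-empty : ∀ n inC f c → Evolved n inC f c → inC ≡ false → f ≡ nothing → c ≡ emp
Evolved-empty n inC f c empty _ _ = refl

labelAtMost : ℕ → Maybe ℕ → Bool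
labelAtMost n (just a) = a ≤ᵇ n
labelAtMost n nothing  = false

cellAtMost : ℕ → Cell → Bool
cellAtMost n c = labelAtMost n (fromCell c)

isBullet : Cell → Bool
isBullet bul = true
isBullet _   = false

isLabel : Cell → Bool
isLabel (lab _) = true
isLabel _       = false

holds : ℕ → Cell → Bool
holds n (lab a) = a ≡ᵇ n
holds n _       = false

labelLE-at : ∀ f n b → labelLE f n b ≡ labelAtMost n (f b)
labelLE-at f n b with f b
... | just _  = refl
... | nothing = refl

filled-fromCell : ∀ (g : Box → Cell) b → filled (λ b' → fromCell (g b')) b ≡ isLabel (g b)
filled-fromCell g b with g b
... | emp   = refl
... | bul   = refl
... | lab _ = refl

isBullet-sound : ∀ c → isBullet c ≡ true → c ≡ bul
isBullet-sound bul _ = refl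

holds-sound : ∀ n c → holds n c ≡ true → c ≡ lab n
holds-sound n (lab a) e = cong lab (≡ᵇ-sound a n e)

cellAtMost-mono : ∀ n c → cellAtMost n c ≡ true → cellAtMost (suc n) c ≡ true
cellAtMost-mono n (lab a) e = ≤ᵇ-true a (suc n) (m≤n⇒m≤1+n (≤ᵇ-sound a n e))

labelAtMost-mono : ∀ n f → labelAtMost n f ≡ true → labelAtMost (suc n) f ≡ true
labelAtMost-mono n (just a) = cellAtMost-mono n (lab a)

cellAtMost⇒¬holds : ∀ n c → cellAtMost n c ≡ true → holds (suc n) c ≡ false
cellAtMost⇒¬holds n (lab a) a≤n = ≡ᵇ-false a (suc n) (<⇒≢ (s≤s (≤ᵇ-sound a n a≤n)))

μ-suc : ∀ X n b → μ X n b ≡ true → μ X (suc n) b ≡ true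
μ-suc X n b b∈ with ∨-cases (inner X b) _ b∈
... | inj₁ b∈λ = ∨-introˡ _ _ b∈λ
... | inj₂ b≤n = ∨-introʳ (inner X b) _ (trans (labelLE-at (fill X) (suc n) b)
                   (labelAtMost-mono n (fill X b) (trans (sym (labelLE-at (fill X) n b)) b≤n)))

cellAtMost-suc : ∀ n c → cellAtMost (suc n) c ≡ cellAtMost n c ∨ holds (suc n) c
cellAtMost-suc n emp = refl
cellAtMost-suc n bul = refl
cellAtMost-suc n (lab a) with <-cmp a (suc n)
... | tri< a<n+1 _ _ rewrite ≤ᵇ-true a (suc n) (<⇒≤ a<n+1) | ≤ᵇ-true a n (≤-pred a<n+1) = refl
... | tri≈ _ refl _ rewrite ≤ᵇ-true a a ≤-refl | ≤ᵇ-false (suc n) n ≤-refl | ≡ᵇ-refl (suc n) = refl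
... | tri> _ _ n+1<a rewrite ≤ᵇ-false a (suc n) n+1<a | ≤ᵇ-false a n (<-trans ≤-refl n+1<a)
                           | ≡ᵇ-false a (suc n) (λ e → <-irrefl (sym e) n+1<a) = refl

cellAtMost-step : ∀ n k c x → n ≤ k → cellAtMost n (stepCell (suc k) c x) ≡ cellAtMost n c
cellAtMost-step n k emp x n≤k = refl
cellAtMost-step n k bul true n≤k = ≤ᵇ-false (suc k) n (s≤s n≤k)
cellAtMost-step n k bul false n≤k = refl
cellAtMost-step n k (lab a) x n≤k with a ≟ suc k
... | yes refl rewrite stepCell-same (suc k) x with x
...   | true  = sym (≤ᵇ-false (suc k) n (s≤s n≤k))
...   | false = refl
cellAtMost-step n k (lab a) x n≤k | no a≢k+1 rewrite stepCell-other (suc k) a x a≢k+1 = refl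

-- Pointwise descriptions of the skew shapes of a growth square, for a box
-- in λ (lv), in C (inC), with original entry f and content c after n steps.
-- μ(T, n) minus μ(slid T, n) consists of the bullets after n steps:
bullets-pointwise : ∀ n lv inC f c → (inC ≡ true → lv ≡ true) → (lv ≡ true → f ≡ nothing) →
  Evolved n inC f c → (lv ∨ labelAtMost n f) ∧ not ((lv ∧ not inC) ∨ cellAtMost n c) ≡ isBullet c
bullets-pointwise n lv true f c C⊆λ _ (corner low) rewrite C⊆λ refl with low
... | low-bul = refl
... | low-lab {a} _ a≤n rewrite ≤ᵇ-true a n a≤n = refl
bullets-pointwise n true  false nothing emp _ _ empty = refl
bullets-pointwise n false false nothing emp _ _ empty = refl
bullets-pointwise n true false (just a) c _ λ-unfilled _ with λ-unfilled refl
... | ()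
bullets-pointwise n false false (just a) (lab a) _ _ (waiting n<a) rewrite ≤ᵇ-false a n n<a = refl
bullets-pointwise n false false (just a) c _ _ (settled a≤n low) rewrite ≤ᵇ-true a n a≤n with low
... | low-bul = refl
... | low-lab {a'} _ a'≤n rewrite ≤ᵇ-true a' n a'≤n = refl

-- μ(T, n + 1) minus μ(T, n) consists of the boxes holding n + 1 after n steps:
arriving-pointwise : ∀ n lv inC f c → (inC ≡ true → lv ≡ true) → (lv ≡ true → f ≡ nothing) →
  Evolved n inC f c → (lv ∨ labelAtMost (suc n) f) ∧ not (lv ∨ labelAtMost n f) ≡ holds (suc n) c
arriving-pointwise n lv true f c C⊆λ _ (corner low) rewrite C⊆λ refl with low
... | low-bul = refl
... | low-lab {a} _ a≤n rewrite ≡ᵇ-false a (suc n) (<⇒≢ (s≤s a≤n)) = refl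
arriving-pointwise n true  false nothing emp _ _ empty = refl
arriving-pointwise n false false nothing emp _ _ empty = refl
arriving-pointwise n true false (just a) c _ λ-unfilled _ with λ-unfilled refl
... | ()
arriving-pointwise n false false (just a) (lab a) _ _ (waiting n<a) rewrite ≤ᵇ-false a n n<a with a ≟ suc n
... | yes refl rewrite ≤ᵇ-true (suc n) (suc n) ≤-refl | ≡ᵇ-refl (suc n) = refl
... | no a≢n+1 rewrite ≤ᵇ-false a (suc n) (≤∧≢⇒< n<a (λ e → a≢n+1 (sym e))) | ≡ᵇ-false a (suc n) a≢n+1 = refl
arriving-pointwise n false false (just a) c _ _ (settled a≤n low)
  rewrite ≤ᵇ-true a n a≤n | ∧-zeroʳ (a ≤ᵇ suc n) with low
... | low-bul = refl
... | low-lab {a'} _ a'≤n rewrite ≡ᵇ-false a' (suc n) (<⇒≢ (s≤s a'≤n)) = refl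

-- and μ(slid T, n + 1) minus μ(slid T, n) of the boxes holding n + 1 after
-- n + 1 steps (kept: the box stays in the inner shape, hence is empty).
arrived-pointwise : ∀ n kept c → (kept ≡ true → c ≡ emp) →
  (kept ∨ cellAtMost (suc n) c) ∧ not (kept ∨ cellAtMost n c) ≡ holds (suc n) c
arrived-pointwise n true c kept-empty rewrite kept-empty refl = refl
arrived-pointwise n false c _ rewrite cellAtMost-suc n c with cellAtMost n c in c≤n
... | true  = sym (cellAtMost⇒¬holds n c c≤n)
... | false = ∧-identityʳ _

-- μ(slid T, n) ⊆ μ(T, n): a label ≤ n after n steps sits where some label ≤ n was.
slid-⊆-pointwise : ∀ n lv inC f c → (inC ≡ true → lv ≡ true) → Evolved n inC f c →
  (lv ∧ not inC) ∨ cellAtMost n c ≡ true → lv ∨ labelAtMost n f ≡ true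
slid-⊆-pointwise n true inC f c _ _ _ = refl
slid-⊆-pointwise n false true f c C⊆λ _ _ with C⊆λ refl
... | ()
slid-⊆-pointwise n false false nothing emp _ empty ()
slid-⊆-pointwise n false false (just a) (lab a) _ (waiting _) e = e
slid-⊆-pointwise n false false (just a) c _ (settled a≤n _) _ = ≤ᵇ-true a n a≤n

double-difference : ∀ a g → (g ≡ true → a ≡ true) → a ∧ not (a ∧ not g) ≡ g
double-difference true  true  _ = refl
double-difference true  false _ = refl
double-difference false true  g⊆a with g⊆a refl
... | ()
double-difference false false _ = refl

union-difference : ∀ a g → (g ≡ true → a ≡ true) → g ∨ (a ∧ not g) ≡ a
union-difference true  true  _ = refl
union-difference true  false _ = refl
union-difference false true  g⊆a with g⊆a refl
... | ()
union-difference false false _ = refl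

repeated-content : ∀ L k g → Increasing L k g → ∀ c₀ → NonEmpty c₀ → ∀ a c c' → c < c' →
  g (at L a c) ≡ c₀ → g (at L a c') ≡ c₀ → ⊥
repeated-content L k g inc c₀ ne a c c' c<c' gx gy = Before-irrefl k c₀
  (subst₂ (Before k) gx gy (inc a c c' c<c' (subst NonEmpty (sym gx) ne) (subst NonEmpty (sym gy) ne)))

same-content-line : ∀ L k g → Increasing L k g → ∀ c₀ → NonEmpty c₀ → ∀ a c c' →
  g (at L a c) ≡ c₀ → g (at L a c') ≡ c₀ → c ≡ c'
same-content-line L k g inc c₀ ne a c c' gx gy with <-cmp c c'
... | tri< c<c' _ _ = ⊥-elim (repeated-content L k g inc c₀ ne a c c' c<c' gx gy)
... | tri≈ _ c≡c' _ = c≡c'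
... | tri> _ _ c'<c = ⊥-elim (repeated-content L k g inc c₀ ne a c' c c'<c gy gx)

rook-set : ∀ k g → (∀ d → Increasing (lines d) k g) → ∀ c₀ → NonEmpty c₀ →
  (S : Shape) → (∀ b → S b ≡ true → g b ≡ c₀) → IsRookSet S
rook-set k g inc c₀ ne S S⇒c₀ (r , c) (r' , c') b∈ b'∈ (inj₁ refl) =
  cong (r ,_) (same-content-line (lines rows) k g (inc rows) c₀ ne r c c' (S⇒c₀ _ b∈) (S⇒c₀ _ b'∈))
rook-set k g inc c₀ ne S S⇒c₀ (r , c) (r' , c') b∈ b'∈ (inj₂ refl) =
  cong (_, c) (same-content-line (lines cols) k g (inc cols) c₀ ne c r r' (S⇒c₀ _ b∈) (S⇒c₀ _ b'∈))

-- The starting configuration of the slide in (G2): the filling by 1's of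
-- β/α with inner shape α, and bullets in α/γ.  (It does not depend on the
-- label bound, which is fixed to 0 here.)
onesStart : Shape → Shape → Shape → Box → Cell
onesStart α β γ = initCells (α ∖ₛ γ) (tab α (onesFill (β ∖ₛ α)) 0)

onesCell : Bool → Bool → Cell
onesCell bullet one = if bullet then bul else toCell (if one then just 1 else nothing)

-- Renaming the label n to 1 and erasing all other labels ('onesCell
-- (isBullet c) (holds n c)'), or in addition exchanging bullets and n
-- ('onesCell (holds n c) (isBullet c)'), turns step n into step 1.
active-renamed : ∀ n c → active 1 (onesCell (isBullet c) (holds n c)) ≡ active n c
active-renamed n emp = refl
active-renamed n bul = refl
active-renamed n (lab a) with a ≡ᵇ n
... | true  = refl
... | false = refl

active-exchanged : ∀ n c → active 1 (onesCell (holds n c) (isBullet c)) ≡ active n c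
active-exchanged n emp = refl
active-exchanged n bul = refl
active-exchanged n (lab a) with a ≡ᵇ n
... | true  = refl
... | false = refl

step-renamed : ∀ n c x → isLabel (stepCell 1 (onesCell (isBullet c) (holds n c)) x) ≡ holds n (stepCell n c x)
step-renamed n emp x = refl
step-renamed n bul true = sym (≡ᵇ-refl n)
step-renamed n bul false = refl
step-renamed n (lab a) x with a ≡ᵇ n in e
... | false = sym e
... | true with x
...   | true  = refl
...   | false = sym e

step-exchanged : ∀ n c x → isLabel (stepCell 1 (onesCell (holds n (stepCell n c x)) (isBullet (stepCell n c x))) x) ≡ isBullet c
step-exchanged n emp x = refl
step-exchanged n bul true rewrite ≡ᵇ-refl n = refl
step-exchanged n bul false = refl
step-exchanged n (lab a) x with a ≡ᵇ n in e
... | false rewrite e = refl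
... | true with x
...   | true  = refl
...   | false rewrite e = refl

activeNeighbour-cong : ∀ i j g g' → (∀ b → active j (g' b) ≡ active i (g b)) →
  ∀ b → activeNeighbour j g' b ≡ activeNeighbour i g b
activeNeighbour-cong i j g g' same b = cong or (map-cong same (neighbours b))

ones-labels : ∀ S q → HasLabels (onesFill S) q → q ≡ 1 ⊎ (q ≡ 0 × ∀ b → S b ≡ false)
ones-labels S zero labels = inj₂ (refl , none)
  where
  none : ∀ b → S b ≡ false
  none b with S b in e
  ... | false = refl
  ... | true with proj₁ labels b 1 (cong (λ v → if v then just 1 else nothing) e)
  ...   | _ , ()
ones-labels S (suc zero) labels = inj₁ refl
ones-labels S (suc (suc q)) labels with proj₂ labels 2 (s≤s z≤n) (s≤s (s≤s z≤n))
... | b , e = ⊥-elim (never-2 (S b) e)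
  where
  never-2 : ∀ v → (if v then just 1 else nothing) ≡ just 2 → ⊥
  never-2 true  ()
  never-2 false ()

-- Step 1 changes nothing if the active cells lie in a rook set: no two of
-- them are neighbours.
kstep-rook : ∀ (g : Box → Cell) (X : Shape) → IsRookSet X →
  (∀ b → active 1 (g b) ≡ true → X b ≡ true) → ∀ b → kstep 1 g b ≡ g b
kstep-rook g X rook active⊆X b rewrite kstep-closed 1 g b with bool-cases (active 1 (g b))
... | inj₂ inactive = stepCell-inactive 1 (g b) _ inactive
... | inj₁ b-active with bool-cases (activeNeighbour 1 g b)
...   | inj₂ isolated rewrite isolated = stepCell-isolated 1 (g b)
...   | inj₁ near with find (any⁻ (λ b' → active 1 (g b')) (neighbours b) (from T-≡ near))
...     | b' , b'∈ , b'-active with neighbour-adjacent b b' b'∈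
...       | b≢b' , aligned = ⊥-elim (b≢b' (rook b b' (active⊆X b b-active) (active⊆X b' (to T-≡ b'-active)) aligned))

onesStart-active : ∀ α β γ → (∀ b → (β ∖ₛ α) b ≡ false) → ∀ b →
  active 1 (onesStart α β γ b) ≡ true → (α ∖ₛ γ) b ≡ true
onesStart-active α β γ none b e with (α ∖ₛ γ) b
... | true = refl
... | false rewrite none b with e
...   | ()

-- (G2) for one square reduces to the effect of step 1 on 'onesStart': the
-- slide performs step 1 (when q = 1) or nothing, which by 'kstep-rook' is
-- the same as step 1 (when q = 0).
slide-prop : ∀ α β γ δ → IsRookSet (α ∖ₛ γ) → (∀ b → γ b ≡ true → α b ≡ true) →
  (∀ b → γ b ∨ isLabel (kstep 1 (onesStart α β γ) b) ≡ δ b) → SlideProp α β γ δ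
slide-prop α β γ δ rook γ⊆α step-one q labels = outer-shape , inner-shape
  where
  start : Box → Cell
  start = onesStart α β γ
  inner-shape : ∀ b → (α ∖ₛ (α ∖ₛ γ)) b ≡ γ b
  inner-shape b = double-difference (α b) (γ b) (γ⊆α b)
  one-step : ∀ b → ksteps q start b ≡ kstep 1 start b
  one-step with ones-labels (β ∖ₛ α) q labels
  ... | inj₁ refl         = λ b → refl
  ... | inj₂ (refl , none) = λ b → sym (kstep-rook start (α ∖ₛ γ) rook (onesStart-active α β γ none) b)
  outer-shape : ∀ b → outer (Kjdt (α ∖ₛ γ) (tab α (onesFill (β ∖ₛ α)) q)) b ≡ δ b
  outer-shape b = begin
    (α ∖ₛ (α ∖ₛ γ)) b ∨ filled (λ b' → fromCell (ksteps q start b')) b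
      ≡⟨ cong₂ _∨_ (inner-shape b) (filled-fromCell (ksteps q start) b) ⟩
    γ b ∨ isLabel (ksteps q start b)
      ≡⟨ cong (λ c → γ b ∨ isLabel c) (one-step b) ⟩
    γ b ∨ isLabel (kstep 1 start b)
      ≡⟨ step-one b ⟩
    δ b ∎
    where open ≡-Reasoning

before-label : ∀ m c a → Before m c (lab a) → a ≤ m → ∃ λ x → c ≡ lab x
before-label m bul     a m<a a≤m = ⊥-elim (<⇒≱ m<a a≤m)
before-label m (lab x) a _   _   = x , refl

module Slide (T : Tableau) (C : Shape) (wf : WellFormed T) (corners : Corners T C) where
  open WellFormed wf

  config : ℕ → Box → Cell
  config n = ksteps n (initCells C T)

  corner-inner : ∀ b → C b ≡ true → inner T b ≡ true
  corner-inner b e = proj₁ (corners b e)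

  filled-outer : ∀ b a → fill T b ≡ just a → outer T b ≡ true
  filled-outer b a e = ∨-introʳ (inner T b) _ (filled-just (fill T) b e)

  unfilled-outer : ∀ b → fill T b ≡ nothing → outer T b ≡ true → inner T b ≡ true
  unfilled-outer b e b∈ν with ∨-cases (inner T b) _ b∈ν
  ... | inj₁ b∈λ     = b∈λ
  ... | inj₂ b-filled = ⊥-elim (true≢false (trans (sym b-filled) (filled-nothing (fill T) b e)))

  evolved : ∀ n b → Evolved n (C b) (fill T b) (config n b)
  evolved zero b with startCell C T b
  ... | start-bul inC g rewrite inC | g = corner low-bul
  ... | start-lab inC a f g rewrite inC | f | g = waiting (proj₁ (label-bounds b a f))
  ... | start-emp inC f g rewrite inC | f | g = empty
  evolved (suc n) b rewrite kstep-closed (suc n) (config n) b =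
    Evolved-step n (C b) (fill T b) (config n b) _ (evolved n b)

  nonEmpty-outer : ∀ n b → NonEmpty (config n b) → outer T b ≡ true
  nonEmpty-outer n b ne with Evolved-origin n _ _ _ (evolved n b) ne
  ... | inj₁ inC      = ∨-introˡ _ _ (corner-inner b inC)
  ... | inj₂ (a , fa) = filled-outer b a fa

  -- No nonempty initial cell precedes a box of λ on a line: corners are
  -- last in λ, and λ carries no labels.
  empty-before-inner : ∀ L a c c' → c < c' → inner T (at L a c') ≡ true →
    NonEmpty (config 0 (at L a c)) → ⊥
  empty-before-inner L a c c' c<c' y∈λ nx with startCell C T (at L a c)
  ... | start-bul cx _ = corner-last L T C corners a c c' c<c' cx y∈λ
  ... | start-lab _ b fx _ =
    just≢nothing (trans (sym fx) (inner-unfilled _ (initial L _ inner-closed a c c' (<⇒≤ c<c') y∈λ)))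
  ... | start-emp _ _ gx = nonEmpty≢emp nx gx

  increasing-start : ∀ d → Increasing (lines d) 0 (config 0)
  increasing-start d a c c' c<c' nx ny with startCell C T (at (lines d) a c')
  ... | start-bul cy _ = ⊥-elim (empty-before-inner (lines d) a c c' c<c' (corner-inner _ cy) nx)
  ... | start-emp _ _ gy = ⊥-elim (nonEmpty≢emp ny gy)
  ... | start-lab _ b' fy gy with startCell C T (at (lines d) a c)
  ...   | start-bul _ gx rewrite gx | gy = proj₁ (label-bounds _ b' fy)
  ...   | start-lab _ b fx gx rewrite gx | gy = fill-increasing d a c c' b b' c<c' fx fy
  ...   | start-emp _ _ gx = ⊥-elim (nonEmpty≢emp nx gx)

  gapless-start : ∀ L → Gapless L (config 0)
  gapless-start L a c c'' c' c<c'' c''<c' nx ny with startCell C T (at L a c'')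
  ... | start-bul _ gz rewrite gz = refl
  ... | start-lab _ _ _ gz rewrite gz = refl
  ... | start-emp _ fz _ = ⊥-elim (empty-before-inner L a c c'' c<c'' z∈λ nx)
    where
    z∈λ : inner T (at L a c'') ≡ true
    z∈λ = unfilled-outer _ fz (initial L _ outer-closed a c'' c' (<⇒≤ c''<c') (nonEmpty-outer 0 _ ny))

  gapless : ∀ L n → Gapless L (config n)
  gapless L zero    = gapless-start L
  gapless L (suc n) = gapless-kstep L (suc n) (config n) (gapless L n)

  increasing : ∀ d n → Increasing (lines d) n (config n)
  increasing d zero    = increasing-start d
  increasing d (suc n) = increasing-kstep (lines d) n (config n) (increasing d n) (gapless (lines d) n)

  slid : Tableau
  slid = Kjdt C T

  kept : Shape
  kept = inner T ∖ₛ C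

  m : ℕ
  m = mx T

  final : Box → Cell
  final = config m

  final-label : ∀ b a → fill slid b ≡ just a → final b ≡ lab a
  final-label b a = fromCell-just (final b)

  final-bounds : ∀ b a → final b ≡ lab a → 1 ≤ a × a ≤ m
  final-bounds b a e = Evolved-bound m _ _ _ a (evolved m b) e (label-bounds b)

  -- λ minus C is down-closed, since the boxes of C are maximal in λ.
  remaining-closed : DownClosed kept
  remaining-closed r c r' c' r'≤r c'≤c b∈ = ∧-intro _ _ x∈λ (not-false _ x∉C)
    where
    b∈λ : inner T (r , c) ≡ true
    b∈λ = ∧-conicalˡ _ _ b∈
    b∉C : C (r , c) ≡ false
    b∉C = not-true _ (∧-conicalʳ _ _ b∈)
    x∈λ : inner T (r' , c') ≡ true
    x∈λ = inner-closed r c r' c' r'≤r c'≤c b∈λ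
    x∉C : C (r' , c') ≡ false
    x∉C with bool-cases (C (r' , c'))
    ... | inj₂ notC = notC
    ... | inj₁ inC  = ⊥-elim (true≢false (trans (sym (subst (λ y → C y ≡ true) x≡b inC)) b∉C))
      where
      x≡b : (r' , c') ≡ (r , c)
      x≡b = corner-maximal T _ (corners _ inC) (r , c) r'≤r c'≤c b∈λ

  -- The outer shape of the slid tableau meets each line in an initial
  -- segment: a filled box y of it was in ν, so every earlier z on its line
  -- was in ν too; z is then either left in λ, or nonempty at the end and
  -- hence (being before a label ≤ m) a label.
  outer-initial : ∀ d a c c' → c ≤ c' → outer slid (at (lines d) a c') ≡ true →
    outer slid (at (lines d) a c) ≡ true
  outer-initial d a c c' c≤c' y∈ with ∨-cases (kept (at (lines d) a c')) _ y∈
  ... | inj₁ y-kept = ∨-introˡ _ _ (initial (lines d) _ remaining-closed a c c' c≤c' y-kept)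
  ... | inj₂ y-filled with filled-true (fill slid) _ y-filled | m≤n⇒m<n∨m≡n c≤c'
  ...   | _ , _ | inj₂ refl = y∈
  ...   | a' , fy | inj₁ c<c' =
    z-cases (∨-cases _ _ (initial (lines d) _ outer-closed a c c' c≤c' (nonEmpty-outer m y ny)))
    where
    y z : Box
    y = at (lines d) a c'
    z = at (lines d) a c
    gy : final y ≡ lab a'
    gy = final-label y a' fy
    ny : NonEmpty (final y)
    ny = subst NonEmpty (sym gy) refl
    from-nonEmpty : NonEmpty (final z) → outer slid z ≡ true
    from-nonEmpty nz with before-label m (final z) a'
      (subst (Before m (final z)) gy (increasing d m a c c' c<c' nz ny)) (proj₂ (final-bounds y a' gy))
    ... | _ , gz = ∨-introʳ _ _ (filled-just (fill slid) z (cong fromCell gz))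
    z-cases : inner T z ≡ true ⊎ filled (fill T) z ≡ true → outer slid z ≡ true
    z-cases (inj₁ z∈λ) with bool-cases (C z)
    ... | inj₂ z∉C = ∨-introˡ _ _ (∧-intro _ _ z∈λ (not-false _ z∉C))
    ... | inj₁ z∈C = from-nonEmpty (Evolved-nonEmpty m _ _ _ (evolved m z) (inj₁ z∈C))
    z-cases (inj₂ z-filled) =
      from-nonEmpty (Evolved-nonEmpty m _ _ _ (evolved m z) (inj₂ (filled-true (fill T) z z-filled)))

  slid-wellFormed : WellFormed slid
  slid-wellFormed = record
    { inner-closed    = remaining-closed
    ; outer-closed    = λ r c r' c' r'≤r c'≤c b∈ →
        outer-initial rows r' c' c c'≤c (outer-initial cols c r' r r'≤r b∈)
    ; inner-unfilled  = λ b b∈ → cong fromCell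
        (Evolved-empty m _ _ _ (evolved m b) (not-true _ (∧-conicalʳ _ _ b∈)) (inner-unfilled b (∧-conicalˡ _ _ b∈)))
    ; label-bounds    = λ b a fa → final-bounds b a (final-label b a fa)
    ; fill-increasing = λ d a c c' x y c<c' fx fy →
        let gx = final-label _ x fx
            gy = final-label _ y fy
        in subst₂ (Before m) gx gy
             (increasing d m a c c' c<c' (subst NonEmpty (sym gx) refl) (subst NonEmpty (sym gy) refl))
    }

  -- Step k + 1 never touches a label ≤ n ≤ k, so labels ≤ n are frozen
  -- after step n.
  frozen-steps : ∀ n k d b → n ≤ k → cellAtMost n (config (d + k) b) ≡ cellAtMost n (config k b)
  frozen-steps n k zero b n≤k = refl
  frozen-steps n k (suc d) b n≤k = begin
    cellAtMost n (config (suc d + k) b)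
      ≡⟨ cong (cellAtMost n) (kstep-closed (suc (d + k)) (config (d + k)) b) ⟩
    cellAtMost n (stepCell (suc (d + k)) (config (d + k) b) _)
      ≡⟨ cellAtMost-step n (d + k) (config (d + k) b) _ (≤-trans n≤k (m≤n+m k d)) ⟩
    cellAtMost n (config (d + k) b)
      ≡⟨ frozen-steps n k d b n≤k ⟩
    cellAtMost n (config k b) ∎
    where open ≡-Reasoning

  frozen : ∀ n k b → n ≤ k → k ≤ m → cellAtMost n (final b) ≡ cellAtMost n (config k b)
  frozen n k b n≤k k≤m =
    trans (cong (λ s → cellAtMost n (config s b)) (sym (m∸n+n≡m k≤m))) (frozen-steps n k (m ∸ k) b n≤k)

  μ-before : ∀ n b → μ T n b ≡ inner T b ∨ labelAtMost n (fill T b)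
  μ-before n b = cong (inner T b ∨_) (labelLE-at (fill T) n b)

  μ-after : ∀ n k b → n ≤ k → k ≤ m → μ slid n b ≡ kept b ∨ cellAtMost n (config k b)
  μ-after n k b n≤k k≤m = cong (kept b ∨_) (trans (labelLE-at (fill slid) n b) (frozen n k b n≤k k≤m))

  bullets : ∀ n b → n ≤ m → (μ T n ∖ₛ μ slid n) b ≡ isBullet (config n b)
  bullets n b n≤m = trans (cong₂ (λ u v → u ∧ not v) (μ-before n b) (μ-after n n b ≤-refl n≤m))
    (bullets-pointwise n _ _ _ _ (corner-inner b) (inner-unfilled b) (evolved n b))

  arriving : ∀ n b → (μ T (suc n) ∖ₛ μ T n) b ≡ holds (suc n) (config n b)
  arriving n b = trans (cong₂ (λ u v → u ∧ not v) (μ-before (suc n) b) (μ-before n b))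
    (arriving-pointwise n _ _ _ _ (corner-inner b) (inner-unfilled b) (evolved n b))

  arrived : ∀ n b → suc n ≤ m → (μ slid (suc n) ∖ₛ μ slid n) b ≡ holds (suc n) (config (suc n) b)
  arrived n b n<m =
    trans (cong₂ (λ u v → u ∧ not v) (μ-after (suc n) (suc n) b ≤-refl n<m) (μ-after n (suc n) b (n≤1+n n) n<m))
      (arrived-pointwise n (kept b) _ kept-empty)
    where
    kept-empty : kept b ≡ true → config (suc n) b ≡ emp
    kept-empty e = Evolved-empty (suc n) _ _ _ (evolved (suc n) b)
      (not-true _ (∧-conicalʳ _ _ e)) (inner-unfilled b (∧-conicalˡ _ _ e))

  μ-slid-⊆ : ∀ n b → n ≤ m → μ slid n b ≡ true → μ T n b ≡ true
  μ-slid-⊆ n b n≤m e = trans (μ-before n b)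
    (slid-⊆-pointwise n _ _ _ _ (corner-inner b) (evolved n b) (trans (sym (μ-after n n b ≤-refl n≤m)) e))

  module Square (i : ℕ) (i<m : i < m) where
    α β γ δ : Shape
    α = μ T i
    β = μ T (suc i)
    γ = μ slid i
    δ = μ slid (suc i)

    g h : Box → Cell
    g = config i
    h = config (suc i)

    i≤m : i ≤ m
    i≤m = <⇒≤ i<m

    -- (G1): each skew shape is the set of boxes holding one fixed content
    -- (a bullet, or i + 1) after i or i + 1 steps.
    rooks : IsRookSet (α ∖ₛ γ) × IsRookSet (β ∖ₛ α) × IsRookSet (β ∖ₛ δ) × IsRookSet (δ ∖ₛ γ)
    rooks =
        rook-set i g (λ d → increasing d i) bul refl _
          (λ b e → isBullet-sound _ (trans (sym (bullets i b i≤m)) e))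
      , rook-set i g (λ d → increasing d i) (lab (suc i)) refl _
          (λ b e → holds-sound _ _ (trans (sym (arriving i b)) e))
      , rook-set (suc i) h (λ d → increasing d (suc i)) bul refl _
          (λ b e → isBullet-sound _ (trans (sym (bullets (suc i) b i<m)) e))
      , rook-set (suc i) h (λ d → increasing d (suc i)) (lab (suc i)) refl _
          (λ b e → holds-sound _ _ (trans (sym (arrived i b i<m)) e))

    -- (G2), first half: step 1 of the slide of 1's in β/α into α/γ is step
    -- i + 1 with i + 1 renamed to 1.
    forward : ∀ b → γ b ∨ isLabel (kstep 1 (onesStart α β γ) b) ≡ δ b
    forward b = begin
      γ b ∨ isLabel (kstep 1 start b)
        ≡⟨ cong (λ c → γ b ∨ isLabel c) (trans (kstep-closed 1 start b) (cong₂ (stepCell 1) (renamed b) (same-flags b))) ⟩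
      γ b ∨ isLabel (stepCell 1 (onesCell (isBullet (g b)) (holds (suc i) (g b))) (activeNeighbour (suc i) g b))
        ≡⟨ cong₂ _∨_ (μ-after i (suc i) b (n≤1+n i) i<m)
             (trans (step-renamed (suc i) (g b) _) (cong (holds (suc i)) (sym (kstep-closed (suc i) g b)))) ⟩
      (kept b ∨ cellAtMost i (h b)) ∨ holds (suc i) (h b)
        ≡⟨ ∨-assoc (kept b) _ _ ⟩
      kept b ∨ (cellAtMost i (h b) ∨ holds (suc i) (h b))
        ≡⟨ cong (kept b ∨_) (sym (cellAtMost-suc i (h b))) ⟩
      kept b ∨ cellAtMost (suc i) (h b)
        ≡⟨ sym (μ-after (suc i) (suc i) b ≤-refl i<m) ⟩
      δ b ∎
      where
      open ≡-Reasoning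
      start : Box → Cell
      start = onesStart α β γ
      renamed : ∀ b → start b ≡ onesCell (isBullet (g b)) (holds (suc i) (g b))
      renamed b = cong₂ onesCell (bullets i b i≤m) (arriving i b)
      same-flags : ∀ b → activeNeighbour 1 start b ≡ activeNeighbour (suc i) g b
      same-flags = activeNeighbour-cong (suc i) 1 g start
        (λ b → trans (cong (active 1) (renamed b)) (active-renamed (suc i) (g b)))

    -- (G2), second half: step 1 of the slide of 1's in β/δ into δ/γ is step
    -- i + 1 run backwards: the 1's land exactly on the bullets of α/γ.
    backward : ∀ b → γ b ∨ isLabel (kstep 1 (onesStart δ β γ) b) ≡ α b
    backward b = begin
      γ b ∨ isLabel (kstep 1 start b)
        ≡⟨ cong (λ c → γ b ∨ isLabel c) (trans (kstep-closed 1 start b) (cong₂ (stepCell 1) (exchanged b) (same-flags b))) ⟩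
      γ b ∨ isLabel (stepCell 1 (onesCell (holds (suc i) (h b)) (isBullet (h b))) (activeNeighbour (suc i) g b))
        ≡⟨ cong (λ c → γ b ∨ isLabel (stepCell 1 (onesCell (holds (suc i) c) (isBullet c)) (activeNeighbour (suc i) g b)))
             (kstep-closed (suc i) g b) ⟩
      γ b ∨ isLabel (stepCell 1 (onesCell (holds (suc i) h-closed) (isBullet h-closed)) (activeNeighbour (suc i) g b))
        ≡⟨ cong (γ b ∨_) (trans (step-exchanged (suc i) (g b) _) (sym (bullets i b i≤m))) ⟩
      γ b ∨ (α ∖ₛ γ) b
        ≡⟨ union-difference (α b) (γ b) (μ-slid-⊆ i b i≤m) ⟩
      α b ∎
      where
      open ≡-Reasoning
      start : Box → Cell
      start = onesStart δ β γ
      h-closed : Cell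
      h-closed = stepCell (suc i) (g b) (activeNeighbour (suc i) g b)
      exchanged : ∀ b → start b ≡ onesCell (holds (suc i) (h b)) (isBullet (h b))
      exchanged b = cong₂ onesCell (arrived i b i<m) (bullets (suc i) b i<m)
      same-flags : ∀ b → activeNeighbour 1 start b ≡ activeNeighbour (suc i) g b
      same-flags = activeNeighbour-cong (suc i) 1 g start
        (λ b → trans (cong (active 1) (exchanged b))
          (trans (active-exchanged (suc i) (h b))
            (trans (cong (active (suc i)) (kstep-closed (suc i) g b)) (stepCell-active (suc i) (g b) _))))

    square : GrowthSquare α β γ δ
    square = rooks
      , slide-prop α β γ δ (proj₁ rooks) (λ b → μ-slid-⊆ i b i≤m) forward
      , slide-prop δ β γ α (proj₂ (proj₂ (proj₂ rooks))) (μ-suc slid i) backward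

run-mx : ∀ T C j → mx (run T C j) ≡ mx T
run-mx T C zero    = refl
run-mx T C (suc j) = run-mx T C j

run-wellFormed : ∀ T C p → WellFormed T → (∀ j → j < p → Corners (run T C j) (C j)) →
  ∀ j → j ≤ p → WellFormed (run T C j)
run-wellFormed T C p wf corners zero    _   = wf
run-wellFormed T C p wf corners (suc j) j<p =
  Slide.slid-wellFormed (run T C j) (C j) (run-wellFormed T C p wf corners j (<⇒≤ j<p)) (corners j j<p)

-- Row p - r of the growth diagram is T_{j+1} for j = p - (r + 1).
p∸r≡1+p∸1+r : ∀ p r → r < p → p ∸ r ≡ suc (p ∸ suc r)
p∸r≡1+p∸1+r (suc p) zero    _         = refl
p∸r≡1+p∸1+r (suc p) (suc r) (s≤s r<p) = p∸r≡1+p∸1+r p r r<p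

-- The square at (i , r) is the growth square of the slide T_j ↦ T_{j+1}
-- at labels i and i + 1.
proposition2p2 : (T : Tableau) → IsIncreasingTableau T →
    (C : ℕ → Shape) (p : ℕ) →
    (∀ j → j < p → IsCornerSet (run T C j) (C j)) →
    IsStraight (run T C p) →
    ∀ i r → i < mx T → r < p →
    GrowthSquare (G T C p i (suc r)) (G T C p (suc i) (suc r)) (G T C p i r) (G T C p (suc i) r)
proposition2p2 T increasing C p corner-sets _ i r i<m r<p rewrite p∸r≡1+p∸1+r p r r<p =
  Slide.Square.square (run T C j) (C j) (run-wellFormed T C p wf corners j (<⇒≤ j<p)) (corners j j<p)
    i (subst (i <_) (sym (run-mx T C j)) i<m)
  where
  j : ℕ
  j = p ∸ suc r
  j<p : j < p
  j<p = ∸-monoʳ-< (s≤s z≤n) r<p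
  wf : WellFormed T
  wf = increasing⇒wellFormed T increasing
  corners : ∀ j → j < p → Corners (run T C j) (C j)
  corners j j<p = proj₂ (corner-sets j j<p)
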